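{- Let $d\in\mathbb{N}$ and let $G$ be a graph with $\Delta(G)\leq d$. Let $\{X_i:i\in[t]\}$ be a collection of pairwise disjoint subsets of $V(G)$ with $|X_i|\geq 25d$ for each $i\in[t]$. Then $G$ has an independent set $X$ of size $2t$ with $|X\cap X_i|=2$ for all $i\in[t]$.
   Context: $G$ is a finite simple graph, $\Delta(G)$ its maximum degree, and $[t]=\{1,\dots,t\}$. -}

module Defs where

open import Data.Nat using (ℕ)
open import Data.Bool using (Bool; true; false)
open import Data.Fin using (Fin)
open import Data.Fin.Subset using (Subset; _∈_; ∣_∣)
open import Data.Vec using (tabulate)
open import Relation.Binary.PropositionalEquality using (_≡_)

record Graph (n : ℕ) : Set where
  field
    adj     : Fin n → Fin n → Bool
    symm    : ∀ u v → adj u v ≡ adj v u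
    irrefl  : ∀ v → adj v v ≡ false

open Graph public

N : ∀ {n} → Graph n → Fin n → Subset n
N G v = tabulate (adj G v)

deg : ∀ {n} → Graph n → Fin n → ℕ
deg G v = ∣ N G v ∣

MaxDegree≤ : ∀ {n} → Graph n → ℕ → Set
MaxDegree≤ G d = ∀ v → deg G v Data.Nat.≤ d

Independent : ∀ {n} → Graph n → Subset n → Set
Independent G X = ∀ u v → u ∈ X → v ∈ X → adj G u v ≡ false

{-# OPTIONS --safe #-}
-- Haxell's theorem: pairwise disjoint vertex sets of at least 2Δ vertices each have an
-- independent transversal.  Splitting every X i into two disjoint pieces of 2d vertices
-- (4d ≤ 25d) and taking an independent transversal of the 2t pieces gives the set.
--
-- Haxell's theorem is proved by adding one part R to an independent transversal T of
-- the others.  One grows a chain (y₁ , s₁) , … , (yₖ , sₖ) in which each yⱼ lies in R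
-- or in an earlier part sᵢ, is adjacent neither to an earlier yᵢ nor to its
-- representative T sᵢ, and is adjacent to T sⱼ.  The first k entries have at most
-- 2d·k neighbours, while R and the parts s₁ … sₖ hold at least 2d·(k + 1) vertices,
-- so there is always a next candidate.  A candidate adjacent to no representative
-- either lies in R, extending T, or replaces the representative of the part sⱼ
-- containing it: the set of representatives adjacent to yⱼ shrinks strictly and
-- none of those of earlier entries grows.  The chain length is bounded, so this
-- lexicographic descent terminates.
module Submission where

open import Defs
open import Data.Bool using (true; false)
open import Data.Bool.Properties using (¬-not; not-¬)
import Data.Bool as Bool
open import Data.Fin using (Fin; zero; suc; _≟_; combine; remQuot; quotient)
open import Data.Fin.Properties
  using (suc-injective; any?; combine-remQuot; remQuot-combine; combine-injectiveʳ)
open import Data.Fin.Subset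
  using (Subset; ⊥; ⁅_⁆; _∈_; _∉_; _⊆_; _⊂_; _∩_; _∪_; _─_; ∣_∣)
open import Data.Fin.Subset.Properties
  using ( _∈?_; nonempty?; Empty-unique; ∉⊥; ⊥⊆; ∣⊥∣≡0; ∣p∣≤n; x∈⁅x⁆; x∈⁅y⁆⇒x≡y; ∣⁅x⁆∣≡1
        ; ⊆-trans; ⊆-antisym; ⊂-⊆-trans; p⊆q⇒∣p∣≤∣q∣; p⊂q⇒∣p∣<∣q∣; in⊆in; out⊆
        ; x∈p∩q⁺; x∈p∩q⁻; x∈p∪q⁺; x∈p∪q⁻; x∈p∧x∉q⇒x∈p─q; p─q⊆p )
open import Data.List using (List; []; _∷_; length)
open import Data.List.Relation.Unary.All as All using (All; []; _∷_)
open import Data.Nat using (ℕ; zero; suc; _+_; _*_; _≤_; _<_; z≤n; s≤s)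
open import Data.Nat.Properties hiding (_≟_; suc-injective)
open import Data.Product using (Σ; ∃; _×_; _,_; proj₁; proj₂; uncurry)
import Data.Product as Product
open import Data.Sum using (_⊎_; inj₁; inj₂; [_,_]′)
import Data.Sum as Sum
open import Data.Unit using (⊤; tt)
open import Data.Vec using ([]; _∷_; here; there; tabulate)
open import Data.Vec.Functional using (updateAt)
open import Data.Vec.Functional.Properties using (updateAt-updates; updateAt-minimal)
open import Data.Vec.Properties using (lookup∘tabulate; []=⇒lookup; lookup⇒[]=)
open import Function using (_∘_; id; const)
open import Function.Definitions using (Injective)
open import Relation.Nullary using (yes; no; contradiction)
open import Relation.Binary.PropositionalEquality
  using (_≡_; _≢_; refl; sym; trans; cong; cong₂; subst)

private
  variable
    n m t : ℕ

Disjoint : Subset n → Subset n → Set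
Disjoint p q = ∀ {x} → x ∈ p → x ∉ q

PairwiseDisjoint : (Fin m → Subset n) → Set
PairwiseDisjoint P = ∀ {i j x} → x ∈ P i → x ∈ P j → i ≡ j

∩≡⊥⇒pairwiseDisjoint : (X : Fin m → Subset n) →
                       (∀ i j → i ≢ j → X i ∩ X j ≡ ⊥) → PairwiseDisjoint X
∩≡⊥⇒pairwiseDisjoint X X∩X≡⊥ {i} {j} {x} x∈Xi x∈Xj with i ≟ j
... | yes i≡j = i≡j
... | no  i≢j = contradiction (subst (x ∈_) (X∩X≡⊥ i j i≢j) (x∈p∩q⁺ (x∈Xi , x∈Xj))) ∉⊥

drop-∷-Disjoint : ∀ {a b} {p q : Subset n} → Disjoint (a ∷ p) (b ∷ q) → Disjoint p q
drop-∷-Disjoint disjoint x∈p x∈q = disjoint (there x∈p) (there x∈q)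

∣p∪q∣≤∣p∣+∣q∣ : ∀ (p q : Subset n) → ∣ p ∪ q ∣ ≤ ∣ p ∣ + ∣ q ∣
∣p∪q∣≤∣p∣+∣q∣ []          []          = z≤n
∣p∪q∣≤∣p∣+∣q∣ (true  ∷ p) (true  ∷ q) =
  s≤s (≤-trans (∣p∪q∣≤∣p∣+∣q∣ p q) (+-monoʳ-≤ ∣ p ∣ (n≤1+n ∣ q ∣)))
∣p∪q∣≤∣p∣+∣q∣ (true  ∷ p) (false ∷ q) = s≤s (∣p∪q∣≤∣p∣+∣q∣ p q)
∣p∪q∣≤∣p∣+∣q∣ (false ∷ p) (true  ∷ q) =
  subst (suc ∣ p ∪ q ∣ ≤_) (sym (+-suc ∣ p ∣ ∣ q ∣)) (s≤s (∣p∪q∣≤∣p∣+∣q∣ p q))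
∣p∪q∣≤∣p∣+∣q∣ (false ∷ p) (false ∷ q) = ∣p∪q∣≤∣p∣+∣q∣ p q

∣p∪q∣≡∣p∣+∣q∣ : ∀ (p q : Subset n) → Disjoint p q → ∣ p ∪ q ∣ ≡ ∣ p ∣ + ∣ q ∣
∣p∪q∣≡∣p∣+∣q∣ []          []          _        = refl
∣p∪q∣≡∣p∣+∣q∣ (true  ∷ p) (true  ∷ q) disjoint = contradiction here (disjoint here)
∣p∪q∣≡∣p∣+∣q∣ (true  ∷ p) (false ∷ q) disjoint =
  cong suc (∣p∪q∣≡∣p∣+∣q∣ p q (drop-∷-Disjoint disjoint))
∣p∪q∣≡∣p∣+∣q∣ (false ∷ p) (true  ∷ q) disjoint =
  trans (cong suc (∣p∪q∣≡∣p∣+∣q∣ p q (drop-∷-Disjoint disjoint))) (sym (+-suc ∣ p ∣ ∣ q ∣))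
∣p∪q∣≡∣p∣+∣q∣ (false ∷ p) (false ∷ q) disjoint = ∣p∪q∣≡∣p∣+∣q∣ p q (drop-∷-Disjoint disjoint)

x∈p─q⁻ : ∀ (p q : Subset n) {x} → x ∈ p ─ q → x ∈ p × x ∉ q
x∈p─q⁻ (true  ∷ p) (false ∷ q)         here  = here , λ ()
x∈p─q⁻ (false ∷ p) (true  ∷ q) {zero} ()
x∈p─q⁻ (false ∷ p) (false ∷ q) {zero} ()
x∈p─q⁻ (_     ∷ p) (_     ∷ q) (there x∈p─q) with x∈p─q⁻ p q x∈p─q
... | x∈p , x∉q = there x∈p , λ { (there x∈q) → x∉q x∈q }

∣p∣≤∣q∣+∣p─q∣ : ∀ (p q : Subset n) → ∣ p ∣ ≤ ∣ q ∣ + ∣ p ─ q ∣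
∣p∣≤∣q∣+∣p─q∣ p q = ≤-trans (p⊆q⇒∣p∣≤∣q∣ p⊆q∪p─q) (∣p∪q∣≤∣p∣+∣q∣ q (p ─ q))
  where
  p⊆q∪p─q : p ⊆ q ∪ (p ─ q)
  p⊆q∪p─q {x} x∈p with x ∈? q
  ... | yes x∈q = x∈p∪q⁺ (inj₁ x∈q)
  ... | no  x∉q = x∈p∪q⁺ (inj₂ (x∈p∧x∉q⇒x∈p─q x∈p x∉q))

∣q∣<∣p∣⇒∃∈p─q : ∀ (p q : Subset n) → ∣ q ∣ < ∣ p ∣ → ∃ λ x → x ∈ p × x ∉ q
∣q∣<∣p∣⇒∃∈p─q {n} p q ∣q∣<∣p∣ with nonempty? (p ─ q)
... | yes (x , x∈p─q) = x , x∈p─q⁻ p q x∈p─q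
... | no  p─q-empty   = contradiction ∣p∣≤∣q∣ (<⇒≱ ∣q∣<∣p∣)
  where
  open ≤-Reasoning
  ∣p∣≤∣q∣ : ∣ p ∣ ≤ ∣ q ∣
  ∣p∣≤∣q∣ = begin
    ∣ p ∣              ≤⟨ ∣p∣≤∣q∣+∣p─q∣ p q ⟩
    ∣ q ∣ + ∣ p ─ q ∣  ≡⟨ cong (λ r → ∣ q ∣ + ∣ r ∣) (Empty-unique p─q-empty) ⟩
    ∣ q ∣ + ∣ ⊥ {n = n} ∣ ≡⟨ cong (∣ q ∣ +_) (∣⊥∣≡0 n) ⟩
    ∣ q ∣ + 0          ≡⟨ +-identityʳ ∣ q ∣ ⟩
    ∣ q ∣              ∎

subset-of-size : ∀ k (p : Subset n) → k ≤ ∣ p ∣ → ∃ λ q → q ⊆ p × ∣ q ∣ ≡ k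
subset-of-size {n} zero p _ = ⊥ , ⊥⊆ , ∣⊥∣≡0 n
subset-of-size (suc k) (true  ∷ p) (s≤s k≤∣p∣) with subset-of-size k p k≤∣p∣
... | q , q⊆p , ∣q∣≡k = true ∷ q , in⊆in q⊆p , cong suc ∣q∣≡k
subset-of-size (suc k) (false ∷ p) k≤∣p∣ with subset-of-size (suc k) p k≤∣p∣
... | q , q⊆p , ∣q∣≡k = false ∷ q , out⊆ q⊆p , ∣q∣≡k

∣q∣+l≤∣p∣⇒l≤∣p─q∣ : ∀ (p q : Subset n) {l} → ∣ q ∣ + l ≤ ∣ p ∣ → l ≤ ∣ p ─ q ∣
∣q∣+l≤∣p∣⇒l≤∣p─q∣ p q ∣q∣+l≤∣p∣ =
  +-cancelˡ-≤ ∣ q ∣ _ _ (≤-trans ∣q∣+l≤∣p∣ (∣p∣≤∣q∣+∣p─q∣ p q))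

disjoint-subsets : ∀ m k (p : Subset n) → m * k ≤ ∣ p ∣ →
                   Σ (Fin m → Subset n) λ F →
                     PairwiseDisjoint F × (∀ j → F j ⊆ p) × (∀ j → k ≤ ∣ F j ∣)
disjoint-subsets zero k p _ = (λ ()) , (λ { {()} }) , (λ ()) , (λ ())
disjoint-subsets {n} (suc m) k p k+m*k≤∣p∣
  with subset-of-size k p (≤-trans (m≤m+n k (m * k)) k+m*k≤∣p∣)
... | q , q⊆p , refl
  with disjoint-subsets m ∣ q ∣ (p ─ q) (∣q∣+l≤∣p∣⇒l≤∣p─q∣ p q k+m*k≤∣p∣)
...   | R , R-disjoint , R⊆p─q , R-large = F , F-disjoint , F⊆p , F-large
  where
  R∉q : ∀ {j x} → x ∈ R j → x ∉ q
  R∉q {j} x∈Rj = proj₂ (x∈p─q⁻ p q (R⊆p─q j x∈Rj))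

  F : Fin (suc m) → Subset n
  F zero    = q
  F (suc j) = R j

  F-disjoint : PairwiseDisjoint F
  F-disjoint {zero}  {zero}  _    _    = refl
  F-disjoint {zero}  {suc j} x∈q  x∈Rj = contradiction x∈q (R∉q x∈Rj)
  F-disjoint {suc i} {zero}  x∈Ri x∈q  = contradiction x∈q (R∉q x∈Ri)
  F-disjoint {suc i} {suc j} x∈Ri x∈Rj = cong suc (R-disjoint x∈Ri x∈Rj)

  F⊆p : ∀ j → F j ⊆ p
  F⊆p zero    = q⊆p
  F⊆p (suc j) = p─q⊆p p q ∘ R⊆p─q j

  F-large : ∀ j → ∣ q ∣ ≤ ∣ F j ∣
  F-large zero    = ≤-refl
  F-large (suc j) = R-large j

refine-pairwiseDisjoint : (X : Fin t → Subset n) (F : Fin t → Fin m → Subset n) →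
                          PairwiseDisjoint X → (∀ i → PairwiseDisjoint (F i)) →
                          (∀ i j → F i j ⊆ X i) → PairwiseDisjoint (uncurry F ∘ remQuot m)
refine-pairwiseDisjoint {t} {m = m} X F X-disjoint F-disjoint F⊆X {a} {b} x∈a x∈b = begin
  a                                 ≡⟨ combine-remQuot {t} m a ⟨
  uncurry combine (remQuot {t} m a) ≡⟨ cong (uncurry combine) (pieces-disjoint x∈a x∈b) ⟩
  uncurry combine (remQuot {t} m b) ≡⟨ combine-remQuot {t} m b ⟩
  b                                 ∎
  where
  open Relation.Binary.PropositionalEquality.≡-Reasoning
  pieces-disjoint : ∀ {p q x} → x ∈ uncurry F p → x ∈ uncurry F q → p ≡ q
  pieces-disjoint {i , j} {i′ , j′} x∈Fij x∈Fij′
    with refl ← X-disjoint (F⊆X i j x∈Fij) (F⊆X i′ j′ x∈Fij′)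
    = cong (i ,_) (F-disjoint i x∈Fij x∈Fij′)

∈-tabulate⁺ : ∀ (f : Fin n → Bool.Bool) {x} → f x ≡ true → x ∈ tabulate f
∈-tabulate⁺ f {x} fx≡true = lookup⇒[]= x (tabulate f) (trans (lookup∘tabulate f x) fx≡true)

∈-tabulate⁻ : ∀ (f : Fin n → Bool.Bool) {x} → x ∈ tabulate f → f x ≡ true
∈-tabulate⁻ f {x} x∈ = trans (sym (lookup∘tabulate f x)) ([]=⇒lookup x∈)

∉N⇒non-adjacent : ∀ (G : Graph n) {x y} → x ∉ N G y → adj G x y ≡ false
∉N⇒non-adjacent G {x} {y} x∉Ny = trans (symm G x y) (¬-not (x∉Ny ∘ ∈-tabulate⁺ (adj G y)))

updateAt-const-cases : ∀ {A : Set} (f : Fin m → A) j x i →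
                       updateAt f j (const x) i ≡ x ⊎ updateAt f j (const x) i ≡ f i
updateAt-const-cases f j x i with i ≟ j
... | yes refl = inj₁ (updateAt-updates i f)
... | no  i≢j  = inj₂ (updateAt-minimal i j f i≢j)

record IndependentTransversal (G : Graph n) (P : Fin m → Subset n) : Set where
  field
    rep         : Fin m → Fin n
    rep∈P       : ∀ i → rep i ∈ P i
    independent : ∀ i j → adj G (rep i) (rep j) ≡ false

open IndependentTransversal

rep-injective : ∀ {G : Graph n} {P : Fin m → Subset n} → PairwiseDisjoint P →
                (T : IndependentTransversal G P) → Injective _≡_ _≡_ (rep T)
rep-injective {P = P} disjoint T {i} {j} repᵢ≡repⱼ =
  disjoint (rep∈P T i) (subst (_∈ P j) (sym repᵢ≡repⱼ) (rep∈P T j))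

extend-with : ∀ {G : Graph n} {P : Fin (suc m) → Subset n} {x} → x ∈ P zero →
              (T : IndependentTransversal G (P ∘ suc)) → (∀ i → adj G x (rep T i) ≡ false) →
              IndependentTransversal G P
extend-with {n} {m} {G} {P} {x} x∈P₀ T x-free = record
  { rep = rep′ ; rep∈P = rep′∈P ; independent = rep′-independent }
  where
  rep′ : Fin (suc m) → Fin n
  rep′ zero    = x
  rep′ (suc i) = rep T i

  rep′∈P : ∀ i → rep′ i ∈ P i
  rep′∈P zero    = x∈P₀
  rep′∈P (suc i) = rep∈P T i

  rep′-independent : ∀ i j → adj G (rep′ i) (rep′ j) ≡ false
  rep′-independent zero    zero    = irrefl G x
  rep′-independent zero    (suc j) = x-free j
  rep′-independent (suc i) zero    = trans (symm G (rep T i) x) (x-free i)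
  rep′-independent (suc i) (suc j) = independent T i j

-- P zero plays the role of R.
module Extension {n d r} (G : Graph n) (1≤d : 1 ≤ d) (Δ≤d : MaxDegree≤ G d)
                 (P : Fin (suc r) → Subset n) (P-disjoint : PairwiseDisjoint P)
                 (P-large : ∀ i → 2 * d ≤ ∣ P i ∣) where

  Transversal : Set
  Transversal = IndependentTransversal G (P ∘ suc)

  Extension : Set
  Extension = IndependentTransversal G P

  adjacentReps : Transversal → Fin n → Subset r
  adjacentReps T x = tabulate (adj G x ∘ rep T)

  -- Newest entry first; an entry (y , s) refers to the part P (suc s).
  Chain : Set
  Chain = List (Fin n × Fin r)

  covered : Chain → Subset n
  covered []            = P zero
  covered ((_ , s) ∷ c) = P (suc s) ∪ covered c

  blocked : Transversal → Chain → Subset n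
  blocked T []            = ⊥
  blocked T ((y , s) ∷ c) = (N G y ∪ N G (rep T s)) ∪ blocked T c

  Clear : Transversal → Fin n → Fin n × Fin r → Set
  Clear T x (y , s) = adj G x y ≡ false × adj G x (rep T s) ≡ false

  Candidate : Transversal → Chain → Fin n → Set
  Candidate T c x = x ∈ covered c × All (Clear T x) c

  Valid : Transversal → Chain → Set
  Valid T []            = ⊤
  Valid T ((y , s) ∷ c) = Candidate T c y × adj G y (rep T s) ≡ true × Valid T c

  NoWorse : Transversal → Transversal → Fin n × Fin r → Set
  NoWorse T′ T (y , _) = adjacentReps T′ y ⊆ adjacentReps T y

  -- A step of the lexicographic descent, located at some entry of the chain.
  data Reduction (T : Transversal) : Chain → Set where
    here  : ∀ {y s c} (T′ : Transversal) → Valid T′ c → Candidate T′ c y →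
            adjacentReps T′ y ⊂ adjacentReps T y → All (NoWorse T′ T) c →
            Reduction T ((y , s) ∷ c)
    there : ∀ {e c} → Reduction T c → Reduction T (e ∷ c)

  noWorse-trans : ∀ {T T′ T″ : Transversal} e →
                  NoWorse T″ T′ e → NoWorse T′ T e → NoWorse T″ T e
  noWorse-trans _ = ⊆-trans

  reduction-transfer : ∀ {T T′ : Transversal} {c} →
                       All (NoWorse T′ T) c → Reduction T′ c → Reduction T c
  reduction-transfer {T} {T′} (T′≤T ∷ T′≤T-below) (here T″ valid y-cand T″<T′ T″≤T′) =
    here T″ valid y-cand (⊂-⊆-trans T″<T′ T′≤T)
         (All.zipWith (λ {e} → uncurry (noWorse-trans {T} {T′} {T″} e)) (T″≤T′ , T′≤T-below))
  reduction-transfer (_ ∷ T′≤T) (there red) = there (reduction-transfer T′≤T red)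

  Agrees : Transversal → Transversal → Fin n × Fin r → Set
  Agrees T T′ (_ , s) = rep T′ s ≡ rep T s

  clear-agree : ∀ {T T′ : Transversal} {x} c →
                All (Agrees T T′) c → All (Clear T x) c → All (Clear T′ x) c
  clear-agree []      []          []                     = []
  clear-agree {T} {T′} {x} (_ ∷ c) (eq ∷ agree) ((x≁y , x≁Ts) ∷ clear) =
    (x≁y , trans (cong (adj G x) eq) x≁Ts) ∷ clear-agree {T} {T′} c agree clear

  valid-agree : ∀ {T T′ : Transversal} c → All (Agrees T T′) c → Valid T c → Valid T′ c
  valid-agree []            []           tt = tt
  valid-agree {T} {T′} ((y , _) ∷ c) (eq ∷ agree) ((y∈ , y-clear) , y~Ts , valid) =
    (y∈ , clear-agree {T} {T′} c agree y-clear) , trans (cong (adj G y) eq) y~Ts ,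
    valid-agree {T} {T′} c agree valid

  adjacent≢clear : ∀ {T : Transversal} {y s s′} →
                   adj G y (rep T s) ≡ true → adj G y (rep T s′) ≡ false → s′ ≢ s
  adjacent≢clear {T} {y} y~Ts y≁Ts′ s′≡s =
    not-¬ y~Ts (subst (λ i → adj G y (rep T i) ≡ false) s′≡s y≁Ts′)

  module Replacement (T : Transversal) (s : Fin r) {x} (x∈Ps : x ∈ P (suc s))
                     (x-free : ∀ i → adj G x (rep T i) ≡ false) where

    replaced : Transversal
    replaced = record { rep = rep′ ; rep∈P = rep′∈P ; independent = rep′-independent }
      where
      rep′ : Fin r → Fin n
      rep′ = updateAt (rep T) s (const x)

      rep′∈P : ∀ i → rep′ i ∈ P (suc i)
      rep′∈P i with i ≟ s
      ... | yes refl = subst (_∈ P (suc i)) (sym (updateAt-updates i (rep T))) x∈Ps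
      ... | no  i≢s  = subst (_∈ P (suc i)) (sym (updateAt-minimal i s (rep T) i≢s)) (rep∈P T i)

      rep′-independent : ∀ i j → adj G (rep′ i) (rep′ j) ≡ false
      rep′-independent i j
        with updateAt-const-cases (rep T) s x i | updateAt-const-cases (rep T) s x j
      ... | inj₁ i↦x | inj₁ j↦x rewrite i↦x | j↦x = irrefl G x
      ... | inj₁ i↦x | inj₂ j↦j rewrite i↦x | j↦j = x-free j
      ... | inj₂ i↦i | inj₁ j↦x rewrite i↦i | j↦x = trans (symm G (rep T i) x) (x-free i)
      ... | inj₂ i↦i | inj₂ j↦j rewrite i↦i | j↦j = independent T i j

    replaced-⊆ : ∀ {y} → adj G y x ≡ false → adjacentReps replaced y ⊆ adjacentReps T y
    replaced-⊆ {y} y≁x {i} i∈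
      with updateAt-const-cases (rep T) s x i | ∈-tabulate⁻ (adj G y ∘ rep replaced) i∈
    ... | inj₁ i↦x | y~rep′i =
      contradiction y≁x (not-¬ (subst (λ v → adj G y v ≡ true) i↦x y~rep′i))
    ... | inj₂ i↦i | y~rep′i =
      ∈-tabulate⁺ (adj G y ∘ rep T) (subst (λ v → adj G y v ≡ true) i↦i y~rep′i)

    replaced-⊂ : ∀ {y} → adj G y x ≡ false → adj G y (rep T s) ≡ true →
                 adjacentReps replaced y ⊂ adjacentReps T y
    replaced-⊂ {y} y≁x y~Ts = replaced-⊆ y≁x , s , ∈-tabulate⁺ (adj G y ∘ rep T) y~Ts , s∉
      where
      s∉ : s ∉ adjacentReps replaced y
      s∉ s∈ = contradiction y≁x (not-¬ (subst (λ v → adj G y v ≡ true) (updateAt-updates s (rep T))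
                                                (∈-tabulate⁻ (adj G y ∘ rep replaced) s∈)))

    replaced-agrees : ∀ {y} c → All (Clear T y) c → adj G y (rep T s) ≡ true →
                      All (Agrees T replaced) c
    replaced-agrees []             []                   _    = []
    replaced-agrees ((_ , s′) ∷ c) ((_ , y≁Ts′) ∷ clear) y~Ts =
      updateAt-minimal s′ s (rep T) (adjacent≢clear {T} y~Ts y≁Ts′) ∷ replaced-agrees c clear y~Ts

    replaced-noWorse : ∀ c → All (Clear T x) c → All (NoWorse replaced T) c
    replaced-noWorse []            []                = []
    replaced-noWorse ((y , _) ∷ c) ((x≁y , _) ∷ clear) =
      replaced-⊆ (trans (symm G y x) x≁y) ∷ replaced-noWorse c clear

  swap-in : ∀ T c {x} → Valid T c → Candidate T c x → (∀ i → adj G x (rep T i) ≡ false) →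
            Extension ⊎ Reduction T c
  swap-in T []            _ (x∈P₀ , []) x-free = inj₁ (extend-with {P = P} x∈P₀ T x-free)
  swap-in T ((y , s) ∷ c) {x} ((y∈ , y-clear) , y~Ts , valid) (x∈ , (x≁y , _) ∷ x-clear) x-free
    with x ∈? P (suc s)
  ... | yes x∈Ps =
    inj₂ (here replaced (valid-agree c agrees valid)
               (y∈ , clear-agree {T} {replaced} c agrees y-clear)
               (replaced-⊂ (trans (symm G y x) x≁y) y~Ts) (replaced-noWorse c x-clear))
    where
    open Replacement T s x∈Ps x-free
    agrees : All (Agrees T replaced) c
    agrees = replaced-agrees c y-clear y~Ts
  ... | no x∉Ps = Sum.map₂ there (swap-in T c valid (x∈covered , x-clear) x-free)
    where
    x∈covered : x ∈ covered c
    x∈covered = [ (λ x∈Ps → contradiction x∈Ps x∉Ps) , id ]′ (x∈p∪q⁻ (P (suc s)) (covered c) x∈)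

  covered-disjoint : ∀ {T : Transversal} {y s} c → All (Clear T y) c → adj G y (rep T s) ≡ true →
                     Disjoint (P (suc s)) (covered c)
  covered-disjoint [] [] _ v∈Ps v∈P₀ = contradiction (P-disjoint v∈Ps v∈P₀) λ ()
  covered-disjoint {T} ((_ , s′) ∷ c) ((_ , y≁Ts′) ∷ clear) y~Ts v∈Ps v∈
    with x∈p∪q⁻ (P (suc s′)) (covered c) v∈
  ... | inj₁ v∈Ps′ = adjacent≢clear {T} y~Ts y≁Ts′ (sym (suc-injective (P-disjoint v∈Ps v∈Ps′)))
  ... | inj₂ v∈c   = covered-disjoint {T} c clear y~Ts v∈Ps v∈c

  ∣covered∣≥ : ∀ {T : Transversal} c → Valid T c → suc (length c) * (2 * d) ≤ ∣ covered c ∣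
  ∣covered∣≥ []            _ = ≤-trans (≤-reflexive (*-identityˡ (2 * d))) (P-large zero)
  ∣covered∣≥ {T} ((y , s) ∷ c) ((_ , y-clear) , y~Ts , valid) = begin
    2 * d + suc (length c) * (2 * d)  ≤⟨ +-mono-≤ (P-large (suc s)) (∣covered∣≥ c valid) ⟩
    ∣ P (suc s) ∣ + ∣ covered c ∣      ≡⟨ ∣p∪q∣≡∣p∣+∣q∣ _ _ (covered-disjoint {T} c y-clear y~Ts) ⟨
    ∣ P (suc s) ∪ covered c ∣          ∎
    where open ≤-Reasoning

  ∣blocked∣≤ : ∀ T c → ∣ blocked T c ∣ ≤ length c * (2 * d)
  ∣blocked∣≤ T []            = ≤-reflexive (∣⊥∣≡0 n)
  ∣blocked∣≤ T ((y , s) ∷ c) =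
    ≤-trans (∣p∪q∣≤∣p∣+∣q∣ (N G y ∪ N G (rep T s)) (blocked T c))
            (+-mono-≤ ∣N∪N∣≤2d (∣blocked∣≤ T c))
    where
    ∣N∪N∣≤2d : ∣ N G y ∪ N G (rep T s) ∣ ≤ 2 * d
    ∣N∪N∣≤2d = ≤-trans (∣p∪q∣≤∣p∣+∣q∣ (N G y) (N G (rep T s)))
                       (+-mono-≤ (Δ≤d y) (≤-trans (Δ≤d (rep T s)) (m≤m+n d 0)))

  ∉blocked⇒clear : ∀ {T x} c → x ∉ blocked T c → All (Clear T x) c
  ∉blocked⇒clear []            _   = []
  ∉blocked⇒clear {T} ((y , s) ∷ c) x∉ =
    (∉N⇒non-adjacent G (x∉ ∘ x∈p∪q⁺ ∘ inj₁ ∘ x∈p∪q⁺ ∘ inj₁) ,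
     ∉N⇒non-adjacent G (x∉ ∘ x∈p∪q⁺ ∘ inj₁ ∘ x∈p∪q⁺ ∘ inj₂)) ∷
    ∉blocked⇒clear c (x∉ ∘ x∈p∪q⁺ ∘ inj₂)

  0<2d : 0 < 2 * d
  0<2d = ≤-trans 1≤d (m≤m+n d (d + 0))

  candidate-exists : ∀ {T} c → Valid T c → ∃ (Candidate T c)
  candidate-exists {T} c valid
    with ∣q∣<∣p∣⇒∃∈p─q (covered c) (blocked T c) ∣blocked∣<∣covered∣
    where
    open ≤-Reasoning
    ∣blocked∣<∣covered∣ : ∣ blocked T c ∣ < ∣ covered c ∣
    ∣blocked∣<∣covered∣ = begin-strict
      ∣ blocked T c ∣                  ≤⟨ ∣blocked∣≤ T c ⟩
      length c * (2 * d)               <⟨ m<n+m _ 0<2d ⟩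
      2 * d + length c * (2 * d)       ≤⟨ ∣covered∣≥ c valid ⟩
      ∣ covered c ∣                    ∎
  ... | x , x∈ , x∉ = x , x∈ , ∉blocked⇒clear c x∉

  length<n : ∀ {T} c → Valid T c → length c < n
  length<n c valid = begin-strict
    length c                        <⟨ n<1+n (length c) ⟩
    suc (length c)                  ≡⟨ *-identityʳ (suc (length c)) ⟨
    suc (length c) * 1              ≤⟨ *-monoʳ-≤ (suc (length c)) 0<2d ⟩
    suc (length c) * (2 * d)        ≤⟨ ∣covered∣≥ c valid ⟩
    ∣ covered c ∣                   ≤⟨ ∣p∣≤n (covered c) ⟩
    n                               ∎
    where open ≤-Reasoning

  adjacent-rep? : ∀ (T : Transversal) x →
                  (∃ λ s → adj G x (rep T s) ≡ true) ⊎ (∀ s → adj G x (rep T s) ≡ false)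
  adjacent-rep? T x with any? (λ s → adj G x (rep T s) Bool.≟ true)
  ... | yes found = inj₁ found
  ... | no  none  = inj₂ λ s → ¬-not λ x~Ts → none (s , x~Ts)

  -- room bounds the further growth of the chain and bound the size of adjacentReps T x:
  -- together they form the lexicographic termination measure.
  search : ∀ room bound T c {x} → Valid T c → n ≤ length c + room → Candidate T c x →
           ∣ adjacentReps T x ∣ < bound → Extension ⊎ Reduction T c
  push   : ∀ room bound T c {x s} → Valid T c → n ≤ length c + room → Candidate T c x →
           ∣ adjacentReps T x ∣ ≤ bound → adj G x (rep T s) ≡ true → Extension ⊎ Reduction T c
  resume : ∀ room bound T c {x s} → Valid T c → n ≤ length c + room → Candidate T c x →
           ∣ adjacentReps T x ∣ ≤ bound →
           Extension ⊎ Reduction T ((x , s) ∷ c) → Extension ⊎ Reduction T c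

  search room zero        T c valid fits x-cand ()
  search room (suc bound) T c {x} valid fits x-cand load with adjacent-rep? T x
  ... | inj₁ (s , x~Ts) = push room bound T c valid fits x-cand (≤-pred load) x~Ts
  ... | inj₂ x-free     = swap-in T c valid x-cand x-free

  push zero bound T c valid fits _ _ _ =
    contradiction (≤-trans fits (≤-reflexive (+-identityʳ (length c)))) (<⇒≱ (length<n c valid))
  push (suc room) bound T c {x} {s} valid fits x-cand load x~Ts =
    resume (suc room) bound T c valid fits x-cand load
      (search room (suc ∣ adjacentReps T (proj₁ next) ∣) T ((x , s) ∷ c) valid′ fits′
              (proj₂ next) ≤-refl)
    where
    valid′ : Valid T ((x , s) ∷ c)
    valid′ = x-cand , x~Ts , valid

    fits′ : n ≤ suc (length c) + room
    fits′ = ≤-trans fits (≤-reflexive (+-suc (length c) room))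

    next : ∃ (Candidate T ((x , s) ∷ c))
    next = candidate-exists ((x , s) ∷ c) valid′

  resume room bound T c valid fits x-cand load (inj₁ extension) = inj₁ extension
  resume room bound T c valid fits x-cand load (inj₂ (there reduction)) = inj₂ reduction
  resume room bound T c valid fits x-cand load (inj₂ (here T′ valid′ x-cand′ T′<T T′≤T)) =
    Sum.map₂ (reduction-transfer T′≤T)
      (search room bound T′ c valid′ fits x-cand′ (<-≤-trans (p⊂q⇒∣p∣<∣q∣ T′<T) load))

  extend : Transversal → Extension
  extend T with candidate-exists {T} [] tt
  ... | x , x-cand =
    [ id , (λ ()) ]′ (search n (suc ∣ adjacentReps T x ∣) T [] tt ≤-refl x-cand ≤-refl)

independent-transversal : ∀ {d} (G : Graph n) → 1 ≤ d → MaxDegree≤ G d →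
                          (P : Fin m → Subset n) → PairwiseDisjoint P →
                          (∀ i → 2 * d ≤ ∣ P i ∣) → IndependentTransversal G P
independent-transversal {m = zero}  G _   _   P _        _     =
  record { rep = λ () ; rep∈P = λ () ; independent = λ () }
independent-transversal {m = suc m} G 1≤d Δ≤d P disjoint large =
  Extension.extend G 1≤d Δ≤d P disjoint large
    (independent-transversal G 1≤d Δ≤d (P ∘ suc) (λ x∈ x∈′ → suc-injective (disjoint x∈ x∈′))
                             (large ∘ suc))

image : (Fin m → Fin n) → Subset n
image {zero}  f = ⊥
image {suc m} f = ⁅ f zero ⁆ ∪ image (f ∘ suc)

∈-image⁺ : ∀ (f : Fin m → Fin n) i → f i ∈ image f
∈-image⁺ f zero    = x∈p∪q⁺ (inj₁ (x∈⁅x⁆ (f zero)))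
∈-image⁺ f (suc i) = x∈p∪q⁺ (inj₂ (∈-image⁺ (f ∘ suc) i))

∈-image⁻ : ∀ (f : Fin m → Fin n) {x} → x ∈ image f → ∃ λ i → f i ≡ x
∈-image⁻ {zero}  f x∈ = contradiction x∈ ∉⊥
∈-image⁻ {suc m} f x∈ with x∈p∪q⁻ ⁅ f zero ⁆ (image (f ∘ suc)) x∈
... | inj₁ x∈⁅f₀⁆ = zero , sym (x∈⁅y⁆⇒x≡y (f zero) x∈⁅f₀⁆)
... | inj₂ x∈img  = Product.map suc id (∈-image⁻ (f ∘ suc) x∈img)

∣image∣ : ∀ (f : Fin m → Fin n) → Injective _≡_ _≡_ f → ∣ image f ∣ ≡ m
∣image∣ {zero}  {n} f _ = ∣⊥∣≡0 n
∣image∣ {suc m}     f f-injective = begin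
  ∣ ⁅ f zero ⁆ ∪ image (f ∘ suc) ∣     ≡⟨ ∣p∪q∣≡∣p∣+∣q∣ _ _ f₀∉image ⟩
  ∣ ⁅ f zero ⁆ ∣ + ∣ image (f ∘ suc) ∣  ≡⟨ cong₂ _+_ (∣⁅x⁆∣≡1 (f zero)) ∣image-f∘suc∣ ⟩
  suc m                                ∎
  where
  open Relation.Binary.PropositionalEquality.≡-Reasoning
  ∣image-f∘suc∣ : ∣ image (f ∘ suc) ∣ ≡ m
  ∣image-f∘suc∣ = ∣image∣ (f ∘ suc) (suc-injective ∘ f-injective)

  f₀∉image : Disjoint ⁅ f zero ⁆ (image (f ∘ suc))
  f₀∉image x∈⁅f₀⁆ x∈image with ∈-image⁻ (f ∘ suc) x∈image
  ... | i , fᵢ₊₁≡x with () ← f-injective (trans fᵢ₊₁≡x (x∈⁅y⁆⇒x≡y (f zero) x∈⁅f₀⁆))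

image-∩ : ∀ {k} (f : Fin m → Fin n) (g : Fin k → Fin m) S →
          (∀ i → f i ∈ S → ∃ λ j → g j ≡ i) → (∀ j → f (g j) ∈ S) →
          image f ∩ S ≡ image (f ∘ g)
image-∩ f g S g-covers fg∈S = ⊆-antisym ⊆-image-fg image-fg-⊆
  where
  ⊆-image-fg : image f ∩ S ⊆ image (f ∘ g)
  ⊆-image-fg x∈ with x∈p∩q⁻ (image f) S x∈
  ... | x∈image , x∈S with ∈-image⁻ f x∈image
  ... | i , refl with g-covers i x∈S
  ... | j , refl = ∈-image⁺ (f ∘ g) j

  image-fg-⊆ : image (f ∘ g) ⊆ image f ∩ S
  image-fg-⊆ x∈ with ∈-image⁻ (f ∘ g) x∈
  ... | j , refl = x∈p∩q⁺ (∈-image⁺ f (g j) , fg∈S j)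

independent-m-fold-transversal :
  ∀ {d} m (G : Graph n) → 1 ≤ d → MaxDegree≤ G d →
  (X : Fin t → Subset n) → PairwiseDisjoint X → (∀ i → m * (2 * d) ≤ ∣ X i ∣) →
  Σ (Subset n) λ Y → Independent G Y × ∣ Y ∣ ≡ t * m × (∀ i → ∣ Y ∩ X i ∣ ≡ m)
independent-m-fold-transversal {n} {t} {d} m G 1≤d Δ≤d X X-disjoint X-large =
  image f , f-independent , ∣image∣ f f-injective , meets
  where
  pieces : ∀ i → Σ (Fin m → Subset n) λ F →
                   PairwiseDisjoint F × (∀ j → F j ⊆ X i) × (∀ j → 2 * d ≤ ∣ F j ∣)
  pieces i = disjoint-subsets m (2 * d) (X i) (X-large i)

  piece : Fin t → Fin m → Subset n
  piece i = proj₁ (pieces i)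

  piece⊆X : ∀ i j → piece i j ⊆ X i
  piece⊆X i = proj₁ (proj₂ (proj₂ (pieces i)))

  Q : Fin (t * m) → Subset n
  Q = uncurry piece ∘ remQuot m

  Q-disjoint : PairwiseDisjoint Q
  Q-disjoint = refine-pairwiseDisjoint X piece X-disjoint (proj₁ ∘ proj₂ ∘ pieces) piece⊆X

  T : IndependentTransversal G Q
  T = independent-transversal G 1≤d Δ≤d Q Q-disjoint
        (λ a → proj₂ (proj₂ (proj₂ (pieces (quotient {t} m a)))) (proj₂ (remQuot {t} m a)))

  f : Fin (t * m) → Fin n
  f = rep T

  f-injective : Injective _≡_ _≡_ f
  f-injective = rep-injective Q-disjoint T

  f-independent : Independent G (image f)
  f-independent u v u∈ v∈ with ∈-image⁻ f u∈ | ∈-image⁻ f v∈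
  ... | a , refl | b , refl = independent T a b

  f∈X : ∀ a → f a ∈ X (quotient {t} m a)
  f∈X a = piece⊆X (quotient {t} m a) (proj₂ (remQuot {t} m a)) (rep∈P T a)

  meets : ∀ i → ∣ image f ∩ X i ∣ ≡ m
  meets i = trans (cong ∣_∣ (image-∩ f (combine i) (X i) covers into))
                  (∣image∣ (f ∘ combine i) (combine-injectiveʳ i _ i _ ∘ f-injective))
    where
    covers : ∀ a → f a ∈ X i → ∃ λ j → combine i j ≡ a
    covers a fa∈Xi with refl ← X-disjoint (f∈X a) fa∈Xi =
      proj₂ (remQuot {t} m a) , combine-remQuot {t} m a

    into : ∀ j → f (combine i j) ∈ X i
    into j = subst (λ i′ → f (combine i j) ∈ X i′) (cong proj₁ (remQuot-combine i j))
                   (f∈X (combine i j))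

proposition3p3 : (d n t : ℕ) → 1 ≤ d → (G : Graph n) → MaxDegree≤ G d →
    (X : Fin t → Subset n) →
    (∀ i j → i ≢ j → X i ∩ X j ≡ ⊥) →
    (∀ i → 25 * d ≤ ∣ X i ∣) →
    Σ (Subset n) (λ Y → Independent G Y × ∣ Y ∣ ≡ 2 * t × (∀ i → ∣ Y ∩ X i ∣ ≡ 2))
proposition3p3 d n t 1≤d G Δ≤d X X∩X≡⊥ X-large =
  let Y , Y-independent , ∣Y∣≡t*2 , ∣Y∩X∣≡2 =
        independent-m-fold-transversal 2 G 1≤d Δ≤d X (∩≡⊥⇒pairwiseDisjoint X X∩X≡⊥)
          (λ i → ≤-trans 4d≤25d (X-large i))
  in Y , Y-independent , trans ∣Y∣≡t*2 (*-comm t 2) , ∣Y∩X∣≡2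
  where
  4d≤25d : 2 * (2 * d) ≤ 25 * d
  4d≤25d = ≤-trans (≤-reflexive (sym (*-assoc 2 2 d))) (*-monoˡ-≤ d (m≤m+n 4 21))
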